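{- If $A$ is a finite $2$-regular set of real numbers and $l\geq 2$ is an integer, then $A$ has a $\left(1+\frac{1}{l}\right)$-regular subset $A'$ with \[|A'|\geq \frac{|A|}{4l+2}.\]
   Context: For $L\geq 1$, a finite increasing sequence of real numbers $a_1<\cdots<a_n$ (equivalently, a finite set of reals listed in increasing order) is called $L$-regular if there is a positive real number $X$ such that $X\leq a_{i+1}-a_i\leq LX$ for all $i=1,\ldots,n-1$. -}

module Defs where

open import Level using (0ℓ)
open import Data.Nat using (ℕ; zero; suc)
open import Data.Unit using (⊤)
open import Data.Product using (Σ; ∃; _×_; _,_)
open import Data.Sum using (_⊎_)
open import Data.List using (List; []; _∷_)
open import Relation.Nullary using (¬_)
open import Relation.Binary.PropositionalEquality using (_≡_)
open import Algebra.Structures using (IsCommutativeRing)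
open import Relation.Binary.Structures using (IsStrictTotalOrder)

-- An axiomatic copy of the real numbers: a complete ordered field
-- (unique up to isomorphism), with propositional equality on the carrier.
record RealField : Set₁ where
  infixl 6 _+ᵣ_
  infixl 7 _*ᵣ_
  infix 4 _<ᵣ_
  field
    ℝ : Set
    0ᵣ 1ᵣ : ℝ
    _+ᵣ_ _*ᵣ_ : ℝ → ℝ → ℝ
    -ᵣ_ : ℝ → ℝ
    _⁻¹ᵣ : ℝ → ℝ
    _<ᵣ_ : ℝ → ℝ → Set
    isCommutativeRing : IsCommutativeRing _≡_ _+ᵣ_ _*ᵣ_ -ᵣ_ 0ᵣ 1ᵣ
    inverse : ∀ x → ¬ (x ≡ 0ᵣ) → x *ᵣ (x ⁻¹ᵣ) ≡ 1ᵣ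
    isStrictTotalOrder : IsStrictTotalOrder _≡_ _<ᵣ_
    0<1 : 0ᵣ <ᵣ 1ᵣ
    +-mono-< : ∀ x y z → x <ᵣ y → x +ᵣ z <ᵣ y +ᵣ z
    *-pos : ∀ x y → 0ᵣ <ᵣ x → 0ᵣ <ᵣ y → 0ᵣ <ᵣ x *ᵣ y
    sup : (P : ℝ → Set) → ∃ P →
          (∃ λ b → ∀ x → P x → (x <ᵣ b ⊎ x ≡ b)) →
          ∃ λ s → (∀ x → P x → (x <ᵣ s ⊎ x ≡ s)) ×
                  (∀ b → (∀ x → P x → (x <ᵣ b ⊎ x ≡ b)) → (s <ᵣ b ⊎ s ≡ b))

module RealOps (R : RealField) where
  open RealField R

  infix 4 _≤ᵣ_
  _≤ᵣ_ : ℝ → ℝ → Set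
  x ≤ᵣ y = x <ᵣ y ⊎ x ≡ y

  _-ᵣ_ : ℝ → ℝ → ℝ
  x -ᵣ y = x +ᵣ (-ᵣ y)

  fromℕᵣ : ℕ → ℝ
  fromℕᵣ zero = 0ᵣ
  fromℕᵣ (suc n) = 1ᵣ +ᵣ fromℕᵣ n

  Consecutive : (ℝ → ℝ → Set) → List ℝ → Set
  Consecutive P [] = ⊤
  Consecutive P (x ∷ []) = ⊤
  Consecutive P (x ∷ y ∷ xs) = P x y × Consecutive P (y ∷ xs)

  Increasing : List ℝ → Set
  Increasing = Consecutive _<ᵣ_

  Regular : ℝ → List ℝ → Set
  Regular L as = Increasing as ×
    Σ ℝ (λ X → 0ᵣ <ᵣ X ×
      Consecutive (λ a b → X ≤ᵣ b -ᵣ a × b -ᵣ a ≤ᵣ L *ᵣ X) as)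

-- Choose the threshold D = 2lX, where X is the regularity scale of A, and thin A
-- greedily: keep an element exactly when it lies at distance at least D from the
-- last kept one. Gaps of A are at most 2X, so every gap of the thinned set lies
-- in [D, D + 2X] = [D, (1 + 1/l) D]. Gaps of A are at least X, so a kept element
-- together with the discarded ones following it makes up at most 2l elements of A,
-- whence |A| ≤ 2l |A'|.
module Submission where

open import Defs
open import Data.Nat using (ℕ; zero; suc; z≤n; s≤s; _≤_; _+_; _*_)
import Data.Nat.Properties as ℕ
open import Data.Product using (Σ; _×_; _,_; proj₁; proj₂)
open import Data.Sum using (_⊎_; inj₁; inj₂)
open import Data.Unit using (tt)
open import Data.Empty using (⊥-elim)
open import Data.List using (List; []; _∷_; length)
open import Data.List.Relation.Binary.Sublist.Propositional using (_⊆_)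
open import Data.List.Relation.Binary.Sublist.Heterogeneous.Core using ([]; _∷ʳ_; _∷_)
open import Relation.Nullary using (¬_)
open import Relation.Binary.PropositionalEquality
open import Relation.Binary.Definitions using (tri<; tri≈; tri>)
open import Algebra.Structures using (IsCommutativeRing)
open import Relation.Binary.Structures using (IsStrictTotalOrder)
import Relation.Binary.Construct.StrictToNonStrict as StrictToNonStrict

module OrderedFieldProperties (R : RealField) where
  open RealField R
  open RealOps R
  module CR = IsCommutativeRing isCommutativeRing
  private
    module SO = IsStrictTotalOrder isStrictTotalOrder
    module NonStrict = StrictToNonStrict _≡_ _<ᵣ_

  <-irrefl : ∀ {x} → ¬ (x <ᵣ x)
  <-irrefl = SO.irrefl refl

  ≤-trans : ∀ {x y z} → x ≤ᵣ y → y ≤ᵣ z → x ≤ᵣ z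
  ≤-trans = NonStrict.trans isEquivalence (resp₂ _<ᵣ_) SO.trans

  <-≤-trans : ∀ {x y z} → x <ᵣ y → y ≤ᵣ z → x <ᵣ z
  <-≤-trans = NonStrict.<-≤-trans SO.trans (resp₂ _<ᵣ_ .proj₁)

  ≤-<-trans : ∀ {x y z} → x ≤ᵣ y → y <ᵣ z → x <ᵣ z
  ≤-<-trans = NonStrict.≤-<-trans sym SO.trans (resp₂ _<ᵣ_ .proj₂)

  ≤-or-> : ∀ x y → x ≤ᵣ y ⊎ y <ᵣ x
  ≤-or-> x y with SO.compare x y
  ... | tri< x<y _ _ = inj₁ (inj₁ x<y)
  ... | tri≈ _ x≡y _ = inj₁ (inj₂ x≡y)
  ... | tri> _ _ y<x = inj₂ y<x

  +-monoˡ-≤ : ∀ z {x y} → x ≤ᵣ y → x +ᵣ z ≤ᵣ y +ᵣ z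
  +-monoˡ-≤ z (inj₁ x<y) = inj₁ (+-mono-< _ _ z x<y)
  +-monoˡ-≤ z (inj₂ x≡y) = inj₂ (cong (_+ᵣ z) x≡y)

  +-monoʳ-≤ : ∀ z {x y} → x ≤ᵣ y → z +ᵣ x ≤ᵣ z +ᵣ y
  +-monoʳ-≤ z {x} {y} x≤y =
    subst₂ _≤ᵣ_ (CR.+-comm x z) (CR.+-comm y z) (+-monoˡ-≤ z x≤y)

  +-mono-≤ : ∀ {x y u v} → x ≤ᵣ y → u ≤ᵣ v → x +ᵣ u ≤ᵣ y +ᵣ v
  +-mono-≤ {y = y} {u} x≤y u≤v = ≤-trans (+-monoˡ-≤ u x≤y) (+-monoʳ-≤ y u≤v)

  [x-y]+y≡x : ∀ x y → (x -ᵣ y) +ᵣ y ≡ x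
  [x-y]+y≡x x y = begin
    (x +ᵣ -ᵣ y) +ᵣ y   ≡⟨ CR.+-assoc x (-ᵣ y) y ⟩
    x +ᵣ (-ᵣ y +ᵣ y)   ≡⟨ cong (x +ᵣ_) (CR.-‿inverseˡ y) ⟩
    x +ᵣ 0ᵣ            ≡⟨ CR.+-identityʳ x ⟩
    x                  ∎
    where open ≡-Reasoning

  [z-y]+[y-x]≡z-x : ∀ x y z → (z -ᵣ y) +ᵣ (y -ᵣ x) ≡ z -ᵣ x
  [z-y]+[y-x]≡z-x x y z = begin
    (z +ᵣ -ᵣ y) +ᵣ (y +ᵣ -ᵣ x)  ≡⟨ sym (CR.+-assoc (z -ᵣ y) y (-ᵣ x)) ⟩
    ((z -ᵣ y) +ᵣ y) +ᵣ -ᵣ x     ≡⟨ cong (_+ᵣ -ᵣ x) ([x-y]+y≡x z y) ⟩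
    z +ᵣ -ᵣ x                   ∎
    where open ≡-Reasoning

  0<y-x⇒x<y : ∀ {x y} → 0ᵣ <ᵣ y -ᵣ x → x <ᵣ y
  0<y-x⇒x<y {x} {y} 0<y-x =
    subst₂ _<ᵣ_ (CR.+-identityˡ x) ([x-y]+y≡x y x) (+-mono-< _ _ x 0<y-x)

  0<fromℕ-suc : ∀ n → 0ᵣ <ᵣ fromℕᵣ (suc n)
  0≤fromℕ : ∀ n → 0ᵣ ≤ᵣ fromℕᵣ n
  0<fromℕ-suc n = <-≤-trans (subst (0ᵣ <ᵣ_) (sym (CR.+-identityʳ 1ᵣ)) 0<1)
                            (+-monoʳ-≤ 1ᵣ (0≤fromℕ n))
  0≤fromℕ zero    = inj₂ refl
  0≤fromℕ (suc n) = inj₁ (0<fromℕ-suc n)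

  fromℕ-+ : ∀ m n → fromℕᵣ (m + n) ≡ fromℕᵣ m +ᵣ fromℕᵣ n
  fromℕ-+ zero    n = sym (CR.+-identityˡ _)
  fromℕ-+ (suc m) n = trans (cong (1ᵣ +ᵣ_) (fromℕ-+ m n)) (sym (CR.+-assoc _ _ _))

  fromℕ-suc-* : ∀ n x → fromℕᵣ (suc n) *ᵣ x ≡ x +ᵣ fromℕᵣ n *ᵣ x
  fromℕ-suc-* n x = trans (CR.distribʳ x 1ᵣ (fromℕᵣ n)) (cong (_+ᵣ fromℕᵣ n *ᵣ x) (CR.*-identityˡ x))

  fromℕ-suc-*-≤ : ∀ k {d x y z} → d ≤ᵣ z -ᵣ y → fromℕᵣ k *ᵣ d ≤ᵣ y -ᵣ x →
                  fromℕᵣ (suc k) *ᵣ d ≤ᵣ z -ᵣ x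
  fromℕ-suc-*-≤ k {d} {x} {y} {z} d≤z-y kd≤y-x =
    subst₂ _≤ᵣ_ (sym (fromℕ-suc-* k d)) ([z-y]+[y-x]≡z-x x y z) (+-mono-≤ d≤z-y kd≤y-x)

  fromℕ-* : ∀ m n → fromℕᵣ (m * n) ≡ fromℕᵣ m *ᵣ fromℕᵣ n
  fromℕ-* zero    n = sym (CR.zeroˡ (fromℕᵣ n))
  fromℕ-* (suc m) n = begin
    fromℕᵣ (n + m * n)                      ≡⟨ fromℕ-+ n (m * n) ⟩
    fromℕᵣ n +ᵣ fromℕᵣ (m * n)              ≡⟨ cong (fromℕᵣ n +ᵣ_) (fromℕ-* m n) ⟩
    fromℕᵣ n +ᵣ fromℕᵣ m *ᵣ fromℕᵣ n        ≡⟨ sym (fromℕ-suc-* m (fromℕᵣ n)) ⟩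
    fromℕᵣ (suc m) *ᵣ fromℕᵣ n              ∎
    where open ≡-Reasoning

  [1+n⁻¹]*[n*u]≡u+n*u : ∀ n u → ¬ (n ≡ 0ᵣ) → (1ᵣ +ᵣ n ⁻¹ᵣ) *ᵣ (n *ᵣ u) ≡ u +ᵣ n *ᵣ u
  [1+n⁻¹]*[n*u]≡u+n*u n u n≢0 = begin
    (1ᵣ +ᵣ n ⁻¹ᵣ) *ᵣ (n *ᵣ u)              ≡⟨ CR.distribʳ (n *ᵣ u) 1ᵣ (n ⁻¹ᵣ) ⟩
    1ᵣ *ᵣ (n *ᵣ u) +ᵣ n ⁻¹ᵣ *ᵣ (n *ᵣ u)    ≡⟨ cong₂ _+ᵣ_ (CR.*-identityˡ (n *ᵣ u)) n⁻¹*[n*u]≡u ⟩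
    n *ᵣ u +ᵣ u                            ≡⟨ CR.+-comm (n *ᵣ u) u ⟩
    u +ᵣ n *ᵣ u                            ∎
    where
    open ≡-Reasoning
    n⁻¹*[n*u]≡u : n ⁻¹ᵣ *ᵣ (n *ᵣ u) ≡ u
    n⁻¹*[n*u]≡u = begin
      n ⁻¹ᵣ *ᵣ (n *ᵣ u)   ≡⟨ sym (CR.*-assoc (n ⁻¹ᵣ) n u) ⟩
      (n ⁻¹ᵣ *ᵣ n) *ᵣ u   ≡⟨ cong (_*ᵣ u) (trans (CR.*-comm (n ⁻¹ᵣ) n) (inverse n n≢0)) ⟩
      1ᵣ *ᵣ u             ≡⟨ CR.*-identityˡ u ⟩
      u                   ∎

module Thinning (R : RealField) where
  open RealField R
  open RealOps R
  open OrderedFieldProperties R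

  Consecutive-map : ∀ {P Q : ℝ → ℝ → Set} → (∀ {x y} → P x y → Q x y) →
                    ∀ xs → Consecutive P xs → Consecutive Q xs
  Consecutive-map f []           _         = tt
  Consecutive-map f (x ∷ [])     _         = tt
  Consecutive-map f (x ∷ y ∷ xs) (p , ps) = f p , Consecutive-map f (y ∷ xs) ps

  Regular-intro : ∀ {L X} xs → 0ᵣ <ᵣ X →
                  Consecutive (λ a b → X ≤ᵣ b -ᵣ a × b -ᵣ a ≤ᵣ L *ᵣ X) xs → Regular L xs
  Regular-intro xs 0<X gaps =
    Consecutive-map (λ (X≤b-a , _) → 0<y-x⇒x<y (<-≤-trans 0<X X≤b-a)) xs gaps ,
    _ , 0<X , gaps

  thin : ℝ → ℝ → List ℝ → List ℝ
  thin D a []       = []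
  thin D a (x ∷ xs) with ≤-or-> D (x -ᵣ a)
  ... | inj₁ _ = x ∷ thin D x xs
  ... | inj₂ _ = thin D a xs

  thin-⊆ : ∀ D a xs → thin D a xs ⊆ xs
  thin-⊆ D a []       = []
  thin-⊆ D a (x ∷ xs) with ≤-or-> D (x -ᵣ a)
  ... | inj₁ _ = refl ∷ thin-⊆ D x xs
  ... | inj₂ _ = x ∷ʳ thin-⊆ D a xs

  -- p is the element preceding xs; it lies within D of the last kept element a.
  thin-gaps : ∀ {D U} → 0ᵣ ≤ᵣ D → ∀ a p xs → p -ᵣ a ≤ᵣ D →
              Consecutive (λ u v → v -ᵣ u ≤ᵣ U) (p ∷ xs) →
              Consecutive (λ u v → D ≤ᵣ v -ᵣ u × v -ᵣ u ≤ᵣ U +ᵣ D) (a ∷ thin D a xs)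
  thin-gaps 0≤D a p []       p-a≤D _             = tt
  thin-gaps {D} {U} 0≤D a p (x ∷ xs) p-a≤D (x-p≤U , gaps) with ≤-or-> D (x -ᵣ a)
  ... | inj₁ D≤x-a =
    (D≤x-a , subst (_≤ᵣ U +ᵣ D) ([z-y]+[y-x]≡z-x a p x) (+-mono-≤ x-p≤U p-a≤D)) ,
    thin-gaps 0≤D x x xs (subst (_≤ᵣ D) (sym (CR.-‿inverseʳ x)) 0≤D) gaps
  ... | inj₂ x-a<D = thin-gaps 0≤D a x xs (inj₁ x-a<D) gaps

  -- The k elements from just after the last kept element a up to p lie at distance
  -- < D ≤ S X from a and are spread apart by at least X each; hence k < S.
  thin-length-from : ∀ {D X} S k a p xs → D ≤ᵣ fromℕᵣ S *ᵣ X → suc k ≤ S →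
                     fromℕᵣ k *ᵣ X ≤ᵣ p -ᵣ a →
                     Consecutive (λ u v → X ≤ᵣ v -ᵣ u) (p ∷ xs) →
                     suc k + length xs ≤ S * suc (length (thin D a xs))
  thin-length : ∀ {D X} S a xs → D ≤ᵣ fromℕᵣ S *ᵣ X → 1 ≤ S →
                Consecutive (λ u v → X ≤ᵣ v -ᵣ u) (a ∷ xs) →
                length (a ∷ xs) ≤ S * length (a ∷ thin D a xs)

  thin-length-from S k a p []       _ k<S _ _ =
    subst₂ _≤_ (sym (ℕ.+-identityʳ (suc k))) (sym (ℕ.*-identityʳ S)) k<S
  thin-length-from {D} {X} S k a p (x ∷ xs) D≤SX k<S kX≤p-a (X≤x-p , gaps)
    with ≤-or-> D (x -ᵣ a)
  ... | inj₁ _ = begin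
    suc k + suc (length xs)                ≤⟨ ℕ.+-mono-≤ k<S
                                                (thin-length S x xs D≤SX (ℕ.≤-trans (s≤s z≤n) k<S) gaps) ⟩
    S + S * suc (length (thin D x xs))     ≡⟨ sym (ℕ.*-suc S _) ⟩
    S * suc (suc (length (thin D x xs)))   ∎
    where open ℕ.≤-Reasoning
  ... | inj₂ x-a<D with ℕ.m≤n⇒m<n∨m≡n k<S
  ...   | inj₁ k+1<S = subst (_≤ S * suc (length (thin D a xs)))
                         (sym (ℕ.+-suc (suc k) (length xs)))
                         (thin-length-from S (suc k) a x xs D≤SX k+1<S
                           (fromℕ-suc-*-≤ k X≤x-p kX≤p-a) gaps)
  ...   | inj₂ refl = ⊥-elim (<-irrefl (≤-<-trans D≤x-a x-a<D))
    where
    D≤x-a : D ≤ᵣ x -ᵣ a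
    D≤x-a = ≤-trans D≤SX (fromℕ-suc-*-≤ k X≤x-p kX≤p-a)

  thin-length {X = X} S a xs D≤SX 1≤S =
    thin-length-from S 0 a a xs D≤SX 1≤S (inj₂ (trans (CR.zeroˡ X) (sym (CR.-‿inverseʳ a))))

  thin-regular : ∀ {U D L} → 0ᵣ <ᵣ D → U +ᵣ D ≡ L *ᵣ D → ∀ a xs →
                 Consecutive (λ u v → v -ᵣ u ≤ᵣ U) (a ∷ xs) → Regular L (a ∷ thin D a xs)
  thin-regular {D = D} 0<D U+D≡LD a xs gaps =
    Regular-intro (a ∷ thin D a xs) 0<D
      (Consecutive-map (λ (D≤gap , gap≤U+D) → D≤gap , subst (_ ≤ᵣ_) U+D≡LD gap≤U+D) _
        (thin-gaps (inj₁ 0<D) a a xs (subst (_≤ᵣ D) (sym (CR.-‿inverseʳ a)) (inj₁ 0<D)) gaps))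

lemma1 : (R : RealField) → (A : List (RealField.ℝ R)) →
         RealOps.Regular R (RealOps.fromℕᵣ R 2) A →
         (l : ℕ) → 2 ≤ l →
         Σ (List (RealField.ℝ R)) (λ A' → A' ⊆ A ×
           RealOps.Regular R (RealField._+ᵣ_ R (RealField.1ᵣ R) (RealField._⁻¹ᵣ R (RealOps.fromℕᵣ R l))) A' ×
           length A ≤ (4 * l + 2) * length A')
lemma1 R []       _ _ _ = [] , [] , (tt , RealField.1ᵣ R , RealField.0<1 R , tt) , z≤n
-- The argument only needs l ≥ 1.
lemma1 R (a ∷ as) _ zero ()
lemma1 R (a ∷ as) (_ , X , 0<X , gaps) l@(suc l-1) _ =
  a ∷ thin D a as ,
  refl ∷ thin-⊆ D a as ,
  thin-regular 0<D U+D≡LD a as (Consecutive-map proj₂ (a ∷ as) gaps) ,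
  ℕ.≤-trans (thin-length S a as (inj₂ D≡SX) (s≤s z≤n) (Consecutive-map proj₁ (a ∷ as) gaps))
            (ℕ.*-monoˡ-≤ (length (a ∷ thin D a as)) S≤4l+2)
  where
  open RealField R
  open RealOps R
  open OrderedFieldProperties R
  open Thinning R

  S : ℕ
  S = l * 2

  U D : ℝ
  U = fromℕᵣ 2 *ᵣ X
  D = fromℕᵣ l *ᵣ U

  0<D : 0ᵣ <ᵣ D
  0<D = *-pos _ _ (0<fromℕ-suc l-1) (*-pos _ _ (0<fromℕ-suc 1) 0<X)

  U+D≡LD : U +ᵣ D ≡ (1ᵣ +ᵣ fromℕᵣ l ⁻¹ᵣ) *ᵣ D
  U+D≡LD = sym ([1+n⁻¹]*[n*u]≡u+n*u (fromℕᵣ l) U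
             (λ l≡0 → <-irrefl (subst (0ᵣ <ᵣ_) l≡0 (0<fromℕ-suc l-1))))

  D≡SX : D ≡ fromℕᵣ S *ᵣ X
  D≡SX = trans (sym (CR.*-assoc (fromℕᵣ l) (fromℕᵣ 2) X)) (cong (_*ᵣ X) (sym (fromℕ-* l 2)))

  S≤4l+2 : S ≤ 4 * l + 2
  S≤4l+2 = begin
    l * 2      ≡⟨ ℕ.*-comm l 2 ⟩
    2 * l      ≤⟨ ℕ.*-monoˡ-≤ l (ℕ.m≤m+n 2 2) ⟩
    4 * l      ≤⟨ ℕ.m≤m+n (4 * l) 2 ⟩
    4 * l + 2  ∎
    where open ℕ.≤-Reasoning
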